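{- Let $\Phi$ be an irreducible reduced root system of rank $r$ with simple roots $\alpha_1,\dots,\alpha_r$, fundamental weights $\varpi_1,\dots,\varpi_r$, simple reflections $\sigma_1,\dots,\sigma_r$, and let $w_0$ be the longest element of its Weyl group. Fix a reduced expression $w_0=\sigma_{i_t}\sigma_{i_{t-1}}\cdots\sigma_{i_1}$ (so $t=\#\Phi^+$), and for $j=1,\dots,t$ let $\beta_j=\sigma_{i_t}\sigma_{i_{t-1}}\cdots\sigma_{i_{j+1}}(\alpha_{i_j})$ (these are the distinct positive roots). Then for every $k\in\{1,\dots,r\}$, \[ \sum_{j:\ i_j=k}\beta_j=\varpi_k-w_0\varpi_k . \]
   Context: The fundamental weights are defined by $2(\varpi_i,\alpha_j)/(\alpha_j,\alpha_j)=\delta_{ij}$ for a $W$-invariant inner product $(\cdot,\cdot)$.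
   Formalization: The root system lies in ℚ^r and its W-invariant inner product takes rational values. -}

module Defs where

open import Data.Nat using (ℕ; zero; suc) renaming (_≤_ to _≤ℕ_)
open import Data.Integer using (ℤ) renaming (_≤_ to _≤ℤ_; _≥_ to _≥ℤ_)
open import Data.Integer as ℤ using (+_)
open import Data.Rational using (ℚ; 0ℚ; 1ℚ; _+_; _*_; _-_; -_; _<_; _÷_; ≢-nonZero; _≟_)
open import Data.Rational as ℚ using ()
open import Data.Fin using (Fin)
open import Data.Fin as Fin using ()
open import Data.Vec using (Vec; []; _∷_; zipWith; map; replicate; foldr; lookup; tabulate)
open import Data.List using (List; []; _∷_; length)
open import Data.List as List using ()
open import Data.Product using (Σ; _×_; _,_; ∃; proj₁; proj₂)
open import Data.Sum using (_⊎_)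
open import Data.Bool using (Bool; true; false; if_then_else_)
open import Relation.Nullary using (¬_; yes; no)
open import Relation.Nullary.Decidable using (⌊_⌋)
open import Relation.Binary.PropositionalEquality using (_≡_; _≢_)

V : ℕ → Set
V n = Vec ℚ n

0v : ∀ {n} → V n
0v = replicate _ 0ℚ

infixl 6 _+v_ _-v_
_+v_ : ∀ {n} → V n → V n → V n
_+v_ = zipWith _+_

_-v_ : ∀ {n} → V n → V n → V n
_-v_ = zipWith _-_

infixl 7 _·v_
_·v_ : ∀ {n} → ℚ → V n → V n
c ·v v = map (c *_) v

sumℚ : ∀ {n} → Vec ℚ n → ℚ
sumℚ = foldr _ _+_ 0ℚ

lincomb : ∀ {n k} → (Fin k → ℚ) → (Fin k → V n) → V n
lincomb {k = zero}  c v = 0v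
lincomb {k = suc k} c v = (c Fin.zero ·v v Fin.zero) +v lincomb (λ i → c (Fin.suc i)) (λ i → v (Fin.suc i))

ℤ→ℚ : ℤ → ℚ
ℤ→ℚ z = z ℚ./ 1

2ℚ : ℚ
2ℚ = ℤ→ℚ (+ 2)

-- total division (q = 0 gives 0; only ever used with q ≠ 0)
divℚ : ℚ → ℚ → ℚ
divℚ p q with q ≟ 0ℚ
... | yes _ = 0ℚ
... | no q≢0 = _÷_ p q {{≢-nonZero q≢0}}

⟪_⟫⟨_,_⟩ : ∀ {n} → Vec (Vec ℚ n) n → V n → V n → ℚ
⟪ G ⟫⟨ u , v ⟩ = sumℚ (zipWith _*_ u (map (λ row → sumℚ (zipWith _*_ row v)) G))

refl⟨_⟩ : ∀ {n} → Vec (Vec ℚ n) n → V n → V n → V n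
refl⟨ G ⟩ α v = v -v (divℚ (2ℚ * ⟪ G ⟫⟨ v , α ⟩) ⟪ G ⟫⟨ α , α ⟩ ·v α)

-- A (finite, reduced, crystallographic) root system Φ = {root i | i : Fin m}
-- spanning V = ℚ^n (so its rank is n), w.r.t. the inner product with
-- Gram matrix G, together with a chosen base (simple roots) α_1..α_n.
record RootSystem (n : ℕ) : Set where
  field
    G      : Vec (Vec ℚ n) n
    G-sym  : ∀ a b → lookup (lookup G a) b ≡ lookup (lookup G b) a
    G-pos  : ∀ v → v ≢ 0v → 0ℚ < ⟪ G ⟫⟨ v , v ⟩
    m      : ℕ
    root   : Fin m → V n
    root≢0 : ∀ i → root i ≢ 0v
    span   : ∀ v → Σ (Fin m → ℚ) λ c → lincomb c root ≡ v
    reduced : ∀ i j c → root j ≡ c ·v root i → (c ≡ 1ℚ) ⊎ (c ≡ - 1ℚ)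
    refl-closed : ∀ i j → Σ (Fin m) λ l → root l ≡ refl⟨ G ⟩ (root i) (root j)
    integral : ∀ i j → Σ ℤ λ z → divℚ (2ℚ * ⟪ G ⟫⟨ root j , root i ⟩) ⟪ G ⟫⟨ root i , root i ⟩ ≡ ℤ→ℚ z
    simple     : Fin n → V n
    simple-root : ∀ a → Σ (Fin m) λ l → root l ≡ simple a
    simple-indep : ∀ (c : Fin n → ℚ) → lincomb c simple ≡ 0v → ∀ a → c a ≡ 0ℚ
    simple-base : ∀ j → Σ (Fin n → ℤ) λ c →
                    (lincomb (λ a → ℤ→ℚ (c a)) simple ≡ root j)
                    × ((∀ a → c a ≥ℤ + 0) ⊎ (∀ a → c a ≤ℤ + 0))

module _ {n : ℕ} (Φ : RootSystem n) where
  open RootSystem Φ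

  ⟨_,_⟩ : V n → V n → ℚ
  ⟨ u , v ⟩ = ⟪ G ⟫⟨ u , v ⟩

  Irreducible : Set
  Irreducible = ∀ (P : Fin m → Bool) →
    (∀ i j → P i ≡ true → P j ≡ false → ⟨ root i , root j ⟩ ≡ 0ℚ) →
    (∀ i → P i ≡ true) ⊎ (∀ i → P i ≡ false)

  σ : Fin n → V n → V n
  σ a = refl⟨ G ⟩ (simple a)

  act : List (Fin n) → V n → V n
  act []      v = v
  act (a ∷ w) v = σ a (act w v)

  _≈w_ : List (Fin n) → List (Fin n) → Set
  u ≈w w = ∀ v → act u v ≡ act w v

  ReducedExprLongest : List (Fin n) → Set
  ReducedExprLongest w =
    (∀ u → u ≈w w → length w ≤ℕ length u) ×
    (∀ u → Σ (List (Fin n)) λ u′ → (u′ ≈w u) × (length u′ ≤ℕ length w))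

  -- For the word (i_t ∷ i_{t-1} ∷ … ∷ i_1), the list of pairs (i_j , β_j) with
  -- β_j = σ_{i_t} ⋯ σ_{i_{j+1}} (α_{i_j}), listed for j = t, t-1, …, 1.
  labelledBetas : List (Fin n) → List (Fin n × V n)
  labelledBetas []      = []
  labelledBetas (a ∷ w) = (a , simple a) ∷ List.map (λ p → proj₁ p , σ a (proj₂ p)) (labelledBetas w)

  betaSum : Fin n → List (Fin n) → V n
  betaSum k w = List.foldr (λ p acc → (if ⌊ proj₁ p Fin.≟ k ⌋ then proj₂ p else 0v) +v acc) 0v (labelledBetas w)

  FundamentalWeights : (Fin n → V n) → Set
  FundamentalWeights ϖ = ∀ k j →
    divℚ (2ℚ * ⟨ ϖ k , simple j ⟩) ⟨ simple j , simple j ⟩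
      ≡ (if ⌊ k Fin.≟ j ⌋ then 1ℚ else 0ℚ)

module Submission where

-- Write w = i_t ⋯ i_1 as the word (a ∷ w′) with a = i_t.  Then
--   β_t = α_a   and   β_j = σ_a (β′_j)  for j < t,
-- where β′_j are the roots attached to the shorter word w′.  Because σ_a is
-- linear, this gives the recursion
--   betaSum k (a ∷ w′) = δ_{ak} α_a + σ_a (betaSum k w′).
-- On the other hand, by the defining property of fundamental weights,
--   σ_a ϖ_k = ϖ_k − δ_{ak} α_a.
-- Both sides of the theorem therefore satisfy the same recursion, and the
-- identity telescopes by induction on the word.  In particular it holds for
-- EVERY word, reduced or not.

open import Defs
open import Data.Nat using (ℕ)
open import Data.Fin using (Fin; _≟_)
open import Data.List using (List; []; _∷_; foldr; map)
open import Data.Rational using (ℚ; 0ℚ; 1ℚ; _+_; _*_; _-_; 1/_; ≢-nonZero)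
import Data.Rational as ℚ
open import Data.Vec as Vec using (Vec; []; _∷_)
open import Data.Product using (_×_; _,_; proj₁; proj₂)
open import Data.Bool using (Bool; true; false; if_then_else_)
open import Relation.Nullary using (yes; no)
open import Relation.Nullary.Decidable using (⌊_⌋)
open import Relation.Binary.PropositionalEquality
  using (_≡_; refl; sym; trans; cong; cong₂; module ≡-Reasoning)
open import Data.Rational.Solver using (module +-*-Solver)
open +-*-Solver using (solve; _:+_; _:-_; _:*_; _:=_; con)
open import Data.Empty using (⊥-elim)

open ≡-Reasoning

sub-scale-+ : ∀ {n} (u v α : V n) p q →
  (u +v v) -v ((p + q) ·v α) ≡ (u -v (p ·v α)) +v (v -v (q ·v α))
sub-scale-+ [] [] [] p q = refl
sub-scale-+ (x ∷ u) (y ∷ v) (a ∷ α) p q = cong₂ _∷_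
  (solve 5 (λ x y a p q → (x :+ y) :- (p :+ q) :* a := (x :- p :* a) :+ (y :- q :* a)) refl x y a p q)
  (sub-scale-+ u v α p q)

sub-scale-- : ∀ {n} (u v α : V n) p q →
  (u -v v) -v ((p - q) ·v α) ≡ (u -v (p ·v α)) -v (v -v (q ·v α))
sub-scale-- [] [] [] p q = refl
sub-scale-- (x ∷ u) (y ∷ v) (a ∷ α) p q = cong₂ _∷_
  (solve 5 (λ x y a p q → (x :- y) :- (p :- q) :* a := (x :- p :* a) :- (y :- q :* a)) refl x y a p q)
  (sub-scale-- u v α p q)

zero-sub-scale : ∀ {n} (α : V n) → 0v -v (0ℚ ·v α) ≡ 0v
zero-sub-scale [] = refl
zero-sub-scale (a ∷ α) = cong₂ _∷_ (solve 1 (λ a → con 0ℚ :- con 0ℚ :* a := con 0ℚ) refl a) (zero-sub-scale α)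

add-sub-one : ∀ {n} (α u : V n) → α +v (u -v (1ℚ ·v α)) ≡ u
add-sub-one [] [] = refl
add-sub-one (a ∷ α) (x ∷ u) = cong₂ _∷_
  (solve 2 (λ a x → a :+ (x :- con 1ℚ :* a) := x) refl a x) (add-sub-one α u)

zero-add-sub-zero : ∀ {n} (α u : V n) → 0v +v (u -v (0ℚ ·v α)) ≡ u
zero-add-sub-zero [] [] = refl
zero-add-sub-zero (a ∷ α) (x ∷ u) = cong₂ _∷_
  (solve 2 (λ a x → con 0ℚ :+ (x :- con 0ℚ :* a) := x) refl a x) (zero-add-sub-zero α u)

add-sub-assoc : ∀ {n} (p q r : V n) → p +v (q -v r) ≡ (p +v q) -v r
add-sub-assoc [] [] [] = refl
add-sub-assoc (x ∷ p) (y ∷ q) (z ∷ r) = cong₂ _∷_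
  (solve 3 (λ x y z → x :+ (y :- z) := (x :+ y) :- z) refl x y z) (add-sub-assoc p q r)

sub-self : ∀ {n} (u : V n) → u -v u ≡ 0v
sub-self [] = refl
sub-self (x ∷ u) = cong₂ _∷_ (solve 1 (λ x → x :- x := con 0ℚ) refl x) (sub-self u)

-- The Euclidean dot product Σ uᵢ Mᵢ is linear in u; the bilinear form
-- ⟪ G ⟫⟨ u , v ⟩ is this dot product with M = G v.

dot : ∀ {n} → V n → V n → ℚ
dot u M = sumℚ (Vec.zipWith _*_ u M)

dot-+ : ∀ {n} (u v M : V n) → dot (u +v v) M ≡ dot u M + dot v M
dot-+ [] [] [] = refl
dot-+ (x ∷ u) (y ∷ v) (z ∷ M) = begin
  (x + y) * z + dot (u +v v) M     ≡⟨ cong ((x + y) * z +_) (dot-+ u v M) ⟩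
  (x + y) * z + (dot u M + dot v M) ≡⟨ solve 5 (λ x y z a b → (x :+ y) :* z :+ (a :+ b) := (x :* z :+ a) :+ (y :* z :+ b)) refl x y z (dot u M) (dot v M) ⟩
  (x * z + dot u M) + (y * z + dot v M) ∎

dot-- : ∀ {n} (u v M : V n) → dot (u -v v) M ≡ dot u M - dot v M
dot-- [] [] [] = refl
dot-- (x ∷ u) (y ∷ v) (z ∷ M) = begin
  (x - y) * z + dot (u -v v) M     ≡⟨ cong ((x - y) * z +_) (dot-- u v M) ⟩
  (x - y) * z + (dot u M - dot v M) ≡⟨ solve 5 (λ x y z a b → (x :- y) :* z :+ (a :- b) := (x :* z :+ a) :- (y :* z :+ b)) refl x y z (dot u M) (dot v M) ⟩
  (x * z + dot u M) - (y * z + dot v M) ∎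

dot-0 : ∀ {n} (M : V n) → dot 0v M ≡ 0ℚ
dot-0 [] = refl
dot-0 (z ∷ M) = begin
  0ℚ * z + dot 0v M ≡⟨ cong (0ℚ * z +_) (dot-0 M) ⟩
  0ℚ * z + 0ℚ       ≡⟨ solve 1 (λ z → con 0ℚ :* z :+ con 0ℚ := con 0ℚ) refl z ⟩
  0ℚ ∎

-- p ↦ divℚ (2 p) c is ℚ-linear (it is multiplication by 2/c, or zero if c = 0).

half-+ : ∀ p q c → divℚ (2ℚ * (p + q)) c ≡ divℚ (2ℚ * p) c + divℚ (2ℚ * q) c
half-+ p q c with c ℚ.≟ 0ℚ
... | yes _ = refl
... | no c≢0 = solve 3 (λ p q r → con 2ℚ :* (p :+ q) :* r := con 2ℚ :* p :* r :+ con 2ℚ :* q :* r)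
                 refl p q ((1/ c) {{≢-nonZero c≢0}})

half-- : ∀ p q c → divℚ (2ℚ * (p - q)) c ≡ divℚ (2ℚ * p) c - divℚ (2ℚ * q) c
half-- p q c with c ℚ.≟ 0ℚ
... | yes _ = refl
... | no c≢0 = solve 3 (λ p q r → con 2ℚ :* (p :- q) :* r := con 2ℚ :* p :* r :- con 2ℚ :* q :* r)
                 refl p q ((1/ c) {{≢-nonZero c≢0}})

half-0 : ∀ c → divℚ (2ℚ * 0ℚ) c ≡ 0ℚ
half-0 c with c ℚ.≟ 0ℚ
... | yes _ = refl
... | no c≢0 = solve 1 (λ r → con 2ℚ :* con 0ℚ :* r := con 0ℚ) refl ((1/ c) {{≢-nonZero c≢0}})

-- The coroot pairing ⟨v, α^∨⟩ = 2⟨v,α⟩/⟨α,α⟩, so that refl⟨ G ⟩ α v = v − ⟨v, α^∨⟩ α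
-- holds by definition.  It is linear in v for every Gram matrix G.

coroot : ∀ {n} → Vec (Vec ℚ n) n → V n → V n → ℚ
coroot G α v = divℚ (2ℚ * ⟪ G ⟫⟨ v , α ⟩) ⟪ G ⟫⟨ α , α ⟩

module Reflection {n : ℕ} (G : Vec (Vec ℚ n) n) (α : V n) where

  private
    Gα : V n
    Gα = Vec.map (λ row → sumℚ (Vec.zipWith _*_ row α)) G

    αα : ℚ
    αα = ⟪ G ⟫⟨ α , α ⟩

  coroot-+ : ∀ u v → coroot G α (u +v v) ≡ coroot G α u + coroot G α v
  coroot-+ u v = trans (cong (λ x → divℚ (2ℚ * x) αα) (dot-+ u v Gα)) (half-+ (dot u Gα) (dot v Gα) αα)

  coroot-- : ∀ u v → coroot G α (u -v v) ≡ coroot G α u - coroot G α v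
  coroot-- u v = trans (cong (λ x → divℚ (2ℚ * x) αα) (dot-- u v Gα)) (half-- (dot u Gα) (dot v Gα) αα)

  coroot-0 : coroot G α 0v ≡ 0ℚ
  coroot-0 = trans (cong (λ x → divℚ (2ℚ * x) αα) (dot-0 Gα)) (half-0 αα)

  refl-+ : ∀ u v → refl⟨ G ⟩ α (u +v v) ≡ refl⟨ G ⟩ α u +v refl⟨ G ⟩ α v
  refl-+ u v = trans (cong (λ p → (u +v v) -v (p ·v α)) (coroot-+ u v))
                     (sub-scale-+ u v α (coroot G α u) (coroot G α v))

  refl-- : ∀ u v → refl⟨ G ⟩ α (u -v v) ≡ refl⟨ G ⟩ α u -v refl⟨ G ⟩ α v
  refl-- u v = trans (cong (λ p → (u -v v) -v (p ·v α)) (coroot-- u v))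
                     (sub-scale-- u v α (coroot G α u) (coroot G α v))

  refl-0 : refl⟨ G ⟩ α 0v ≡ 0v
  refl-0 = trans (cong (λ p → 0v -v (p ·v α)) coroot-0) (zero-sub-scale α)

  reflect-δ : ∀ (b : Bool) u → coroot G α u ≡ (if b then 1ℚ else 0ℚ) →
              (if b then α else 0v) +v refl⟨ G ⟩ α u ≡ u
  reflect-δ true  u eq = trans (cong (λ p → α +v (u -v (p ·v α))) eq) (add-sub-one α u)
  reflect-δ false u eq = trans (cong (λ p → 0v +v (u -v (p ·v α))) eq) (zero-add-sub-zero α u)

labelSum : ∀ {n} → Fin n → List (Fin n × V n) → V n
labelSum k = foldr (λ p acc → (if ⌊ proj₁ p ≟ k ⌋ then proj₂ p else 0v) +v acc) 0v

labelSum-map : ∀ {n} (f : V n → V n) → f 0v ≡ 0v → (∀ u v → f (u +v v) ≡ f u +v f v) →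
  ∀ k (ps : List (Fin n × V n)) →
  labelSum k (map (λ p → proj₁ p , f (proj₂ p)) ps) ≡ f (labelSum k ps)
labelSum-map f f0 f+ k [] = sym f0
labelSum-map f f0 f+ k ((i , x) ∷ ps) = begin
    (if ⌊ i ≟ k ⌋ then f x else 0v) +v labelSum k (map (λ p → proj₁ p , f (proj₂ p)) ps)
  ≡⟨ cong₂ _+v_ (f-if ⌊ i ≟ k ⌋) (labelSum-map f f0 f+ k ps) ⟩
    f (if ⌊ i ≟ k ⌋ then x else 0v) +v f (labelSum k ps)
  ≡⟨ sym (f+ _ _) ⟩
    f ((if ⌊ i ≟ k ⌋ then x else 0v) +v labelSum k ps) ∎
  where
  f-if : ∀ b → (if b then f x else 0v) ≡ f (if b then x else 0v)
  f-if true  = refl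
  f-if false = sym f0

≟-sym : ∀ {n} (a k : Fin n) → ⌊ a ≟ k ⌋ ≡ ⌊ k ≟ a ⌋
≟-sym a k with a ≟ k | k ≟ a
... | yes _   | yes _   = refl
... | no _    | no _    = refl
... | yes a≡k | no k≢a  = ⊥-elim (k≢a (sym a≡k))
... | no a≢k  | yes k≡a = ⊥-elim (a≢k (sym k≡a))

module Telescoping {n : ℕ} (Φ : RootSystem n) where
  open RootSystem Φ using (G; simple)

  betaSum-∷ : ∀ k a w → betaSum Φ k (a ∷ w) ≡ (if ⌊ a ≟ k ⌋ then simple a else 0v) +v σ Φ a (betaSum Φ k w)
  betaSum-∷ k a w = cong ((if ⌊ a ≟ k ⌋ then simple a else 0v) +v_)
    (labelSum-map (σ Φ a) (Reflection.refl-0 G (simple a)) (Reflection.refl-+ G (simple a)) k (labelledBetas Φ w))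

  reflect-weight : (ϖ : Fin n → V n) → FundamentalWeights Φ ϖ →
    ∀ k a → (if ⌊ a ≟ k ⌋ then simple a else 0v) +v σ Φ a (ϖ k) ≡ ϖ k
  reflect-weight ϖ fw k a =
    Reflection.reflect-δ G (simple a) ⌊ a ≟ k ⌋ (ϖ k) (trans (fw k a) (cong (if_then 1ℚ else 0ℚ) (sym (≟-sym a k))))

  betaSum-telescopes : (ϖ : Fin n → V n) → FundamentalWeights Φ ϖ →
    ∀ k w → betaSum Φ k w ≡ ϖ k -v act Φ w (ϖ k)
  betaSum-telescopes ϖ fw k [] = sym (sub-self (ϖ k))
  betaSum-telescopes ϖ fw k (a ∷ w) = begin
      betaSum Φ k (a ∷ w)
    ≡⟨ betaSum-∷ k a w ⟩
      δα +v σ Φ a (betaSum Φ k w)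
    ≡⟨ cong (λ v → δα +v σ Φ a v) (betaSum-telescopes ϖ fw k w) ⟩
      δα +v σ Φ a (ϖ k -v x)
    ≡⟨ cong (δα +v_) (Reflection.refl-- G (simple a) (ϖ k) x) ⟩
      δα +v (σ Φ a (ϖ k) -v σ Φ a x)
    ≡⟨ add-sub-assoc δα (σ Φ a (ϖ k)) (σ Φ a x) ⟩
      (δα +v σ Φ a (ϖ k)) -v σ Φ a x
    ≡⟨ cong (_-v σ Φ a x) (reflect-weight ϖ fw k a) ⟩
      ϖ k -v σ Φ a x ∎
    where
    δα : V n
    δα = if ⌊ a ≟ k ⌋ then simple a else 0v
    x : V n
    x = act Φ w (ϖ k)

-- Theorem 4.2.
theorem4p2 : ∀ {n : ℕ} (Φ : RootSystem n) → Irreducible Φ →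
    (w : List (Fin n)) → ReducedExprLongest Φ w →
    (ϖ : Fin n → V n) → FundamentalWeights Φ ϖ →
    ∀ (k : Fin n) → betaSum Φ k w ≡ ϖ k -v act Φ w (ϖ k)
theorem4p2 Φ _ w _ ϖ fw k = Telescoping.betaSum-telescopes Φ ϖ fw k w
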